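{- Let $k>1$ be an integer and let $X\in\{\mathbb{R}^k,\mathcal{L}^k\}$. Then for every $n\in\mathbb{N}$, $B_n\le|X_n|$, where $B_n$ is the $n$-th Bell number.
   Context: Two distinct letters $\mathtt a,\mathtt b$ alternate in a word $w$ if deleting all other letters yields one of $(\mathtt{ab})^n$, $(\mathtt{ab})^n\mathtt a$, $(\mathtt{ba})^n$, $(\mathtt{ba})^n\mathtt b$ for some $n\ge1$. A graph $G=(V,E)$ is represented by $w$ if the set of letters of $w$ is $V$ and distinct $\mathtt a,\mathtt b\in V$ alternate in $w$ iff $\{\mathtt a,\mathtt b\}\in E$. A word is $k$-uniform if each of its letters occurs exactly $k$ times; $\mathbb{R}^k$ is the class of graphs represented by some $k$-uniform word. A marking sequence for $w$ is an enumeration $(\mathtt a_1,\dots,\mathtt a_n)$ of the distinct letters of $w$; at stage $i$ all occurrences of $\mathtt a_1,\dots,\mathtt a_i$ are marked, and a marked block is a maximal factor of consecutive marked positions; $w$ is $k$-local if some marking sequence gives at most $k$ marked blocks at every stage. $\mathcal L^k$ is the class of graphs represented by some $k$-local word. For a class of graphs $X$, $X_n=\{G\in X\mid V(G)=\{1,\dots,n\}\}$. The $n$-th Bell number $B_n$ is the number of partitions of an $n$-element set. -}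

module Defs where

open import Data.Nat using (ℕ; zero; suc; _≤_; _<_)
open import Data.Bool using (Bool; true; false; _∨_)
open import Data.Fin using (Fin; _≟_)
open import Data.List using (List; []; _∷_; _++_; length; take; map; filterᵇ; concat; replicate)
open import Data.List.Membership.Propositional using (_∈_)
import Data.List.Membership.DecPropositional as DecMem
open import Data.List.Relation.Unary.Unique.Propositional using (Unique)
open import Data.Product using (Σ; _×_; ∃; ∃-syntax)
open import Data.Sum using (_⊎_)
open import Relation.Nullary using (¬_; does)
open import Relation.Binary.PropositionalEquality using (_≡_)
open import Function.Bundles using (_⇔_)

record Graph (n : ℕ) : Set where
  field
    adj   : Fin n → Fin n → Bool
    symm  : ∀ a b → adj a b ≡ adj b a
    irrfl : ∀ a → adj a a ≡ false
open Graph public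

_≈G_ : ∀ {n} → Graph n → Graph n → Set
G ≈G H = ∀ a b → adj G a b ≡ adj H a b

Word : ℕ → Set
Word n = List (Fin n)

restrict : ∀ {n} → Fin n → Fin n → Word n → Word n
restrict a b = filterᵇ (λ x → does (x ≟ a) ∨ does (x ≟ b))

pow : ∀ {n} → ℕ → Word n → Word n
pow m u = concat (replicate m u)

Alternate : ∀ {n} → Fin n → Fin n → Word n → Set
Alternate a b w =
  ∃[ m ] (1 ≤ m ×
    ( restrict a b w ≡ pow m (a ∷ b ∷ [])
    ⊎ restrict a b w ≡ pow m (a ∷ b ∷ []) ++ (a ∷ [])
    ⊎ restrict a b w ≡ pow m (b ∷ a ∷ [])
    ⊎ restrict a b w ≡ pow m (b ∷ a ∷ []) ++ (b ∷ [])))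

Represents : ∀ {n} → Word n → Graph n → Set
Represents {n} w G =
  (∀ (a : Fin n) → a ∈ w) ×
  (∀ (a b : Fin n) → ¬ a ≡ b → (Alternate a b w ⇔ (adj G a b ≡ true)))

occ : ∀ {n} → Fin n → Word n → ℕ
occ a w = length (filterᵇ (λ x → does (x ≟ a)) w)

Uniform : ∀ {n} → ℕ → Word n → Set
Uniform {n} k w = ∀ (a : Fin n) → occ a w ≡ k

-- number of maximal blocks of consecutive `true`s; the flag records
-- whether the previous position was marked.
blocksAux : Bool → List Bool → ℕ
blocksAux _     []            = 0
blocksAux _     (false ∷ xs)  = blocksAux false xs
blocksAux false (true ∷ xs)   = suc (blocksAux true xs)
blocksAux true  (true ∷ xs)   = blocksAux true xs

blocks : List Bool → ℕ
blocks = blocksAux false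

MarkingSequence : ∀ {n} → Word n → List (Fin n) → Set
MarkingSequence {n} w σ = Unique σ × (∀ (x : Fin n) → (x ∈ σ ⇔ x ∈ w))

marked : ∀ {n} → List (Fin n) → ℕ → Word n → List Bool
marked {n} σ i w = map (λ x → does (x ∈? take i σ)) w
  where open DecMem (_≟_ {n}) using (_∈?_)

Local : ∀ {n} → ℕ → Word n → Set
Local k w = ∃[ σ ] (MarkingSequence w σ ×
  (∀ i → i ≤ length σ → blocks (marked σ i w) ≤ k))

-- The classes ℝᵏ and ℒᵏ, restricted to vertex set {1..n}.

InR : ℕ → ∀ {n} → Graph n → Set
InR k G = ∃[ w ] (Uniform k w × Represents w G)

InL : ℕ → ∀ {n} → Graph n → Set
InL k G = ∃[ w ] (Local k w × Represents w G)

-- Set partitions of {1..n}, represented by their equivalence relation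
-- ("same block"), as a Bool-valued relation.

record Partition (n : ℕ) : Set where
  field
    same      : Fin n → Fin n → Bool
    same-refl : ∀ a → same a a ≡ true
    same-sym  : ∀ a b → same a b ≡ same b a
    same-trans : ∀ a b c → same a b ≡ true → same b c ≡ true → same a c ≡ true
open Partition public

_≈P_ : ∀ {n} → Partition n → Partition n → Set
P ≈P Q = ∀ a b → same P a b ≡ same Q a b

-- B_n ≤ |X_n| : the set of partitions of {1..n} (of size B_n) injects
-- into the set X_n of graphs on {1..n} belonging to X.
BellLe : (X : ∀ {n} → Graph n → Set) → ℕ → Set
BellLe X n = Σ (Partition n → Graph n) λ f →
  (∀ P → X (f P)) × (∀ P Q → f P ≈G f Q → P ≈P Q)

{-# OPTIONS --safe #-}
module Submission where

-- List the blocks of a partition of {1..n} as words C₁, …, C_m and send the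
-- partition to its equivalence graph (one clique per block), represented by
-- the block word C₁ᵏ C₂ᵏ ⋯ C_mᵏ.  Every letter occurs k times.  Two letters
-- of one block alternate in it, as (ab)ᵏ or (ba)ᵏ, while letters of
-- different blocks restrict to aᵏbᵏ or bᵏaᵏ, which starts with a repeated
-- letter since k ≥ 2.  Marking letters in the order C₁ C₂ ⋯ C_m, at every
-- stage the marked positions are the earlier blocks together with the same
-- prefix in each of the k copies of the current block, so there are at most
-- k marked blocks.

open import Defs
open import Data.Bool using (Bool; true; false; T; T?; not; _∧_; _∨_; if_then_else_)
open import Data.Empty using (⊥-elim)
open import Data.Fin using (Fin; _≟_)
open import Data.List using (List; []; _∷_; _++_; length; take; drop; map; concat; replicate; filter; filterᵇ; allFin)
open import Data.List.Properties
  using ( map-++; map-cong-local; map-replicate; concat-map; length-++; ++-assoc; ++-identityʳ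
        ; filter-++; filter-none; take++drop≡id)
open import Data.List.Membership.Propositional using (_∈_; _∉_)
open import Data.List.Membership.Propositional.Properties
  using (∈-++⁺ˡ; ∈-++⁺ʳ; ∈-++⁻; ∈-concat⁺′; ∈-filter⁺; ∈-filter⁻; ∈-map⁺; ∈-map⁻; ∈-allFin)
import Data.List.Membership.DecPropositional as DecMembership
open import Data.List.Relation.Binary.Disjoint.Propositional using (Disjoint)
open import Data.List.Relation.Unary.All as All using (All; []; _∷_)
import Data.List.Relation.Unary.All.Properties as All
import Data.List.Relation.Unary.AllPairs as AllPairs
import Data.List.Relation.Unary.AllPairs.Properties as AllPairs
open import Data.List.Relation.Unary.Any using (here; there)
open import Data.List.Relation.Unary.Unique.Propositional using (Unique; []; _∷_)
import Data.List.Relation.Unary.Unique.Propositional.Properties as Unique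
open import Data.Nat using (ℕ; zero; suc; _+_; _*_; _≤_; z≤n; s≤s)
open import Data.Nat.Properties
  using ( ≤-refl; ≤-trans; ≤-reflexive; n≤1+n; +-mono-≤; +-monoʳ-≤; *-monoʳ-≤
        ; +-identityʳ; *-zeroʳ; *-identityʳ; *-distribˡ-+; module ≤-Reasoning)
open import Data.Product as Product using (_×_; _,_; proj₂; ∃; ∃-syntax)
open import Data.Sum as Sum using (_⊎_; inj₁; inj₂; swap; [_,_]′)
open import Function using (_∘_; case_of_)
open import Function.Bundles using (_⇔_; mk⇔)
open import Relation.Binary.PropositionalEquality
  using (_≡_; _≢_; refl; sym; trans; cong; cong₂; subst; module ≡-Reasoning)
open import Relation.Nullary using (¬_; does; yes; no; contradiction)
open import Relation.Nullary.Decidable using (dec-true; dec-false)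
open import Relation.Unary using (Decidable)

module _ {A : Set} where

  Unique-++⁻ : ∀ xs {ys : List A} → Unique (xs ++ ys) → Unique xs × Unique ys × Disjoint xs ys
  Unique-++⁻ []       u          = [] , u , λ ()
  Unique-++⁻ (x ∷ xs) (x∉ ∷ u) with Unique-++⁻ xs u
  ... | uxs , uys , xs#ys = All.++⁻ˡ xs x∉ ∷ uxs , uys , λ where
    (here refl  , v∈ys) → All.lookup (All.++⁻ʳ xs x∉) v∈ys refl
    (there v∈xs , v∈ys) → xs#ys (v∈xs , v∈ys)

  Unique-concat⁻ : ∀ xss → Unique (concat xss) → All Unique xss
  Unique-concat⁻ []         _ = []
  Unique-concat⁻ (xs ∷ xss) u with Unique-++⁻ xs u
  ... | uxs , uxss , _ = uxs ∷ Unique-concat⁻ xss uxss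

  Unique∧constant⇒length≤1 : {v : List A} → Unique v → (∀ {y z} → y ∈ v → z ∈ v → y ≡ z) → length v ≤ 1
  Unique∧constant⇒length≤1 {[]}        _                 _     = z≤n
  Unique∧constant⇒length≤1 {_ ∷ []}    _                 _     = ≤-refl
  Unique∧constant⇒length≤1 {_ ∷ _ ∷ _} ((y≢z ∷ _) ∷ _) const =
    contradiction (const (here refl) (there (here refl))) y≢z

  Unique∧All≡⇒singleton : {v : List A} {x : A} → Unique v → x ∈ v → All (_≡ x) v → v ≡ x ∷ []
  Unique∧All≡⇒singleton {_ ∷ []}    _                 _ (refl ∷ [])       = refl
  Unique∧All≡⇒singleton {_ ∷ _ ∷ _} ((y≢z ∷ _) ∷ _) _ (refl ∷ refl ∷ _) = contradiction refl y≢z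

  Unique-tail-singleton : ∀ {x y : A} {v} → Unique (x ∷ v) → y ≢ x → y ∈ x ∷ v →
                          All (λ z → z ≡ x ⊎ z ≡ y) v → v ≡ y ∷ []
  Unique-tail-singleton _          y≢x (here y≡x)  _  = contradiction y≡x y≢x
  Unique-tail-singleton (x∉v ∷ uv) _   (there y∈v) xy =
    Unique∧All≡⇒singleton uv y∈v (All.zipWith only-y (x∉v , xy))
    where
    only-y : ∀ {x y z : A} → x ≢ z × (z ≡ x ⊎ z ≡ y) → z ≡ y
    only-y (x≢z , inj₁ z≡x) = contradiction (sym z≡x) x≢z
    only-y (_   , inj₂ z≡y) = z≡y

  Unique-pair : {v : List A} {a b : A} → Unique v → a ≢ b → a ∈ v → b ∈ v →
                All (λ x → x ≡ a ⊎ x ≡ b) v → v ≡ a ∷ b ∷ [] ⊎ v ≡ b ∷ a ∷ []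
  Unique-pair u a≢b _   b∈v (inj₁ refl ∷ ab) =
    inj₁ (cong (_ ∷_) (Unique-tail-singleton u (a≢b ∘ sym) b∈v ab))
  Unique-pair u a≢b a∈v _   (inj₂ refl ∷ ab) =
    inj₂ (cong (_ ∷_) (Unique-tail-singleton u a≢b a∈v (All.map swap ab)))

  ∈-take⁻ : ∀ i {x : A} {u} → x ∈ take i u → x ∈ u
  ∈-take⁻ i {u = u} x∈ = subst (_ ∈_) (take++drop≡id i u) (∈-++⁺ˡ x∈)

  take-++-cases : ∀ i (xs ys : List A) →
                  take i (xs ++ ys) ≡ take i xs ⊎ ∃ λ i′ → take i (xs ++ ys) ≡ xs ++ take i′ ys
  take-++-cases zero    xs       ys = inj₁ refl
  take-++-cases (suc i) []       ys = inj₂ (suc i , refl)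
  take-++-cases (suc i) (x ∷ xs) ys =
    Sum.map (cong (x ∷_)) (Product.map₂ (cong (x ∷_))) (take-++-cases i xs ys)

  replicate-++ : ∀ m n {x : A} → replicate m x ++ replicate n x ≡ replicate (m + n) x
  replicate-++ zero    n = refl
  replicate-++ (suc m) n = cong (_ ∷_) (replicate-++ m n)

  concat-replicate-[] : ∀ k → concat (replicate k []) ≡ ([] {A = A})
  concat-replicate-[] zero    = refl
  concat-replicate-[] (suc k) = concat-replicate-[] k

  filter-concat-replicate : ∀ {P : A → Set} (P? : Decidable P) k u →
                            filter P? (concat (replicate k u)) ≡ concat (replicate k (filter P? u))
  filter-concat-replicate P? zero    u = refl
  filter-concat-replicate P? (suc k) u =
    trans (filter-++ P? u _) (cong (filter P? u ++_) (filter-concat-replicate P? k u))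

  map-concat-replicate : ∀ {B : Set} (f : A → B) k u →
                         map f (concat (replicate k u)) ≡ concat (replicate k (map f u))
  map-concat-replicate f k u = trans (sym (concat-map (replicate k u))) (cong concat (map-replicate (map f) k u))

module _ {n : ℕ} where

  ∈-pow⁻ : ∀ k {x : Fin n} {u} → x ∈ pow k u → x ∈ u
  ∈-pow⁻ (suc k) {u = u} x∈ with ∈-++⁻ u x∈
  ... | inj₁ x∈u  = x∈u
  ... | inj₂ x∈uᵏ = ∈-pow⁻ k x∈uᵏ

  occ-++ : ∀ (x : Fin n) u v → occ x (u ++ v) ≡ occ x u + occ x v
  occ-++ x u v = trans (cong length (filter-++ _ u v)) (length-++ (filterᵇ _ u))

  occ-pow : ∀ (x : Fin n) k u → occ x (pow k u) ≡ k * occ x u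
  occ-pow x zero    u = refl
  occ-pow x (suc k) u = trans (occ-++ x u (pow k u)) (cong (occ x u +_) (occ-pow x k u))

  occ-∉ : ∀ {x : Fin n} {u} → x ∉ u → occ x u ≡ 0
  occ-∉ {x} {[]}    _  = refl
  occ-∉ {x} {y ∷ u} x∉ with y ≟ x
  ... | yes refl = contradiction (here refl) x∉
  ... | no  _    = occ-∉ (x∉ ∘ there)

  occ-Unique : ∀ {x : Fin n} {u} → Unique u → x ∈ u → occ x u ≡ 1
  occ-Unique {x} {y ∷ u} (y∉u ∷ uu) x∈ with y ≟ x | x∈
  ... | yes refl | _         = cong suc (occ-∉ λ x∈u → All.lookup y∉u x∈u refl)
  ... | no  y≢x  | here x≡y  = contradiction (sym x≡y) y≢x
  ... | no  _    | there x∈u = occ-Unique uu x∈u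

  restrict-keeps⁻ : ∀ {x a b : Fin n} → T (does (x ≟ a) ∨ does (x ≟ b)) → x ≡ a ⊎ x ≡ b
  restrict-keeps⁻ {x} {a} {b} t with x ≟ a | x ≟ b
  ... | yes x≡a | _       = inj₁ x≡a
  ... | no  _   | yes x≡b = inj₂ x≡b
  ... | no  _   | no  _   = ⊥-elim t

  restrict-keeps⁺ : ∀ {x a b : Fin n} → x ≡ a ⊎ x ≡ b → T (does (x ≟ a) ∨ does (x ≟ b))
  restrict-keeps⁺ {x} {a} {b} x≡a⊎b with x ≟ a | x ≟ b
  ... | yes _   | _       = _
  ... | no  _   | yes _   = _
  ... | no  x≢a | no  x≢b = [ x≢a , x≢b ]′ x≡a⊎b

  ∈-restrict⁻ : ∀ {x a b : Fin n} {u} → x ∈ restrict a b u → x ∈ u × (x ≡ a ⊎ x ≡ b)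
  ∈-restrict⁻ x∈ with ∈-filter⁻ _ x∈
  ... | x∈u , t = x∈u , restrict-keeps⁻ t

  ∈-restrict⁺ : ∀ {x a b : Fin n} {u} → x ∈ u → x ≡ a ⊎ x ≡ b → x ∈ restrict a b u
  ∈-restrict⁺ x∈u x≡a⊎b = ∈-filter⁺ _ x∈u (restrict-keeps⁺ x≡a⊎b)

  restrict-∉ : ∀ {a b : Fin n} {u} → a ∉ u → b ∉ u → restrict a b u ≡ []
  restrict-∉ {a} {b} a∉u b∉u = filter-none (λ x → T? (does (x ≟ a) ∨ does (x ≟ b)))
    (All.tabulate λ {x} x∈u t → [ (λ { refl → a∉u x∈u }) , (λ { refl → b∉u x∈u }) ]′ (restrict-keeps⁻ {x} {a} {b} t))

  restrict-++ : ∀ (a b : Fin n) u v → restrict a b (u ++ v) ≡ restrict a b u ++ restrict a b v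
  restrict-++ a b = filter-++ _

  blockWord : ℕ → List (Word n) → Word n
  blockWord k cs = concat (map (pow k) cs)

  ∈-blockWord⁻ : ∀ k cs {x} → x ∈ blockWord k cs → x ∈ concat cs
  ∈-blockWord⁻ k (c ∷ cs) x∈ with ∈-++⁻ (pow k c) x∈
  ... | inj₁ x∈cᵏ = ∈-++⁺ˡ (∈-pow⁻ k x∈cᵏ)
  ... | inj₂ x∈w  = ∈-++⁺ʳ c (∈-blockWord⁻ k cs x∈w)

  ∈-blockWord⁺ : ∀ k cs {x} → x ∈ concat cs → x ∈ blockWord (suc k) cs
  ∈-blockWord⁺ k (c ∷ cs) x∈ with ∈-++⁻ c x∈
  ... | inj₁ x∈c = ∈-++⁺ˡ (∈-++⁺ˡ x∈c)
  ... | inj₂ x∈σ = ∈-++⁺ʳ (pow (suc k) c) (∈-blockWord⁺ k cs x∈σ)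

  occ-blockWord : ∀ x k cs → occ x (blockWord k cs) ≡ k * occ x (concat cs)
  occ-blockWord x k []       = sym (*-zeroʳ k)
  occ-blockWord x k (c ∷ cs) = begin
    occ x (pow k c ++ blockWord k cs)        ≡⟨ occ-++ x (pow k c) _ ⟩
    occ x (pow k c) + occ x (blockWord k cs) ≡⟨ cong₂ _+_ (occ-pow x k c) (occ-blockWord x k cs) ⟩
    k * occ x c + k * occ x (concat cs)      ≡⟨ *-distribˡ-+ k (occ x c) _ ⟨
    k * (occ x c + occ x (concat cs))        ≡⟨ cong (k *_) (occ-++ x c (concat cs)) ⟨
    k * occ x (c ++ concat cs)               ∎
    where open ≡-Reasoning

  blockWord-Uniform : ∀ k cs → Unique (concat cs) → (∀ x → x ∈ concat cs) → Uniform {n} k (blockWord k cs)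
  blockWord-Uniform k cs u ∈σ x = begin
    occ x (blockWord k cs)  ≡⟨ occ-blockWord x k cs ⟩
    k * occ x (concat cs)   ≡⟨ cong (k *_) (occ-Unique u (∈σ x)) ⟩
    k * 1                   ≡⟨ *-identityʳ k ⟩
    k                       ∎
    where open ≡-Reasoning

  restrict-blockWord : ∀ a b k cs → restrict a b (blockWord k cs) ≡ blockWord k (map (restrict a b) cs)
  restrict-blockWord a b k []       = refl
  restrict-blockWord a b k (c ∷ cs) = begin
    restrict a b (pow k c ++ blockWord k cs)
      ≡⟨ restrict-++ a b (pow k c) _ ⟩
    restrict a b (pow k c) ++ restrict a b (blockWord k cs)
      ≡⟨ cong₂ _++_ (filter-concat-replicate _ k c) (restrict-blockWord a b k cs) ⟩
    pow k (restrict a b c) ++ blockWord k (map (restrict a b) cs) ∎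
    where open ≡-Reasoning

  restrict-blockWord-∈ : ∀ {a b : Fin n} k {cs c} → Unique (concat cs) → c ∈ cs → a ∈ c → b ∈ c →
                         restrict a b (blockWord k cs) ≡ pow k (restrict a b c)
  restrict-blockWord-∈ {a} {b} k {c ∷ cs} u (here refl) a∈c b∈c with Unique-++⁻ c u
  ... | _ , _ , c#σ = begin
    restrict a b (pow k c ++ blockWord k cs)
      ≡⟨ restrict-++ a b (pow k c) _ ⟩
    restrict a b (pow k c) ++ restrict a b (blockWord k cs)
      ≡⟨ cong₂ _++_ (filter-concat-replicate _ k c) (restrict-∉ (avoid a∈c) (avoid b∈c)) ⟩
    pow k (restrict a b c) ++ []
      ≡⟨ ++-identityʳ _ ⟩
    pow k (restrict a b c) ∎
    where
    open ≡-Reasoning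
    avoid : ∀ {x} → x ∈ c → x ∉ blockWord k cs
    avoid x∈c x∈w = c#σ (x∈c , ∈-blockWord⁻ k cs x∈w)
  restrict-blockWord-∈ {a} {b} k {c′ ∷ cs} {c} u (there c∈cs) a∈c b∈c with Unique-++⁻ c′ u
  ... | _ , uσ , c′#σ = begin
    restrict a b (pow k c′ ++ blockWord k cs)
      ≡⟨ restrict-++ a b (pow k c′) _ ⟩
    restrict a b (pow k c′) ++ restrict a b (blockWord k cs)
      ≡⟨ cong₂ _++_ (restrict-∉ (avoid a∈c) (avoid b∈c)) (restrict-blockWord-∈ k uσ c∈cs a∈c b∈c) ⟩
    pow k (restrict a b c) ∎
    where
    open ≡-Reasoning
    avoid : ∀ {x} → x ∈ c → x ∉ pow k c′
    avoid x∈c x∈c′ᵏ = c′#σ (∈-pow⁻ k x∈c′ᵏ , ∈-concat⁺′ x∈c c∈cs)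

  data Stuttering : Word n → Set where
    []  : Stuttering []
    _∷_ : ∀ x r → Stuttering (x ∷ x ∷ r)

  Stuttering-head : ∀ {w} {x y : Fin n} {r} → Stuttering w → w ≡ x ∷ y ∷ r → x ≡ y
  Stuttering-head []      ()
  Stuttering-head (_ ∷ _) refl = refl

  blockWord-Stuttering : ∀ k us → All (λ u → length u ≤ 1) us → Stuttering (blockWord (2 + k) us)
  blockWord-Stuttering k []                []          = []
  blockWord-Stuttering k ([] ∷ us)         (_ ∷ short) rewrite concat-replicate-[] {A = Fin n} k =
    blockWord-Stuttering k us short
  blockWord-Stuttering k ((x ∷ []) ∷ us)   _           = x ∷ _
  blockWord-Stuttering k ((_ ∷ _ ∷ _) ∷ _) (s≤s () ∷ _)

  Alternate⇒starts-ab : ∀ {a b : Fin n} {w} → Alternate a b w →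
                        (∃ λ r → restrict a b w ≡ a ∷ b ∷ r) ⊎ (∃ λ r → restrict a b w ≡ b ∷ a ∷ r)
  Alternate⇒starts-ab (suc _ , _ , inj₁ w↾ab)               = inj₁ (_ , w↾ab)
  Alternate⇒starts-ab (suc _ , _ , inj₂ (inj₁ w↾ab))        = inj₁ (_ , w↾ab)
  Alternate⇒starts-ab (suc _ , _ , inj₂ (inj₂ (inj₁ w↾ba))) = inj₂ (_ , w↾ba)
  Alternate⇒starts-ab (suc _ , _ , inj₂ (inj₂ (inj₂ w↾ba))) = inj₂ (_ , w↾ba)

  Stuttering⇒¬Alternate : ∀ {a b : Fin n} {w} → a ≢ b → Stuttering (restrict a b w) → ¬ Alternate a b w
  Stuttering⇒¬Alternate {a} {b} {w} a≢b st alt with Alternate⇒starts-ab {a} {b} {w} alt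
  ... | inj₁ (_ , w↾ab) = a≢b (Stuttering-head st w↾ab)
  ... | inj₂ (_ , w↾ba) = a≢b (sym (Stuttering-head st w↾ba))

  blockWord-Alternate : ∀ k {cs c} {a b : Fin n} → Unique (concat cs) → a ≢ b → c ∈ cs → a ∈ c → b ∈ c →
                        Alternate a b (blockWord (suc k) cs)
  blockWord-Alternate k {cs} {c} {a} {b} u a≢b c∈cs a∈c b∈c =
    [ (λ c↾ab → suc k , s≤s z≤n , inj₁ (trans w↾c (cong (pow (suc k)) c↾ab)))
    , (λ c↾ba → suc k , s≤s z≤n , inj₂ (inj₂ (inj₁ (trans w↾c (cong (pow (suc k)) c↾ba)))))
    ]′ c↾ab⊎ba
    where
    w↾c : restrict a b (blockWord (suc k) cs) ≡ pow (suc k) (restrict a b c)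
    w↾c = restrict-blockWord-∈ (suc k) u c∈cs a∈c b∈c
    c↾ab⊎ba : restrict a b c ≡ a ∷ b ∷ [] ⊎ restrict a b c ≡ b ∷ a ∷ []
    c↾ab⊎ba = Unique-pair (Unique.filter⁺ _ (All.lookup (Unique-concat⁻ cs u) c∈cs)) a≢b
      (∈-restrict⁺ a∈c (inj₁ refl)) (∈-restrict⁺ b∈c (inj₂ refl))
      (All.tabulate (proj₂ ∘ ∈-restrict⁻ {a = a} {b} {c}))

  blockWord-¬Alternate : ∀ k {cs} {a b : Fin n} → Unique (concat cs) → a ≢ b →
                         (∀ {c} → c ∈ cs → a ∈ c → b ∉ c) → ¬ Alternate a b (blockWord (2 + k) cs)
  blockWord-¬Alternate k {cs} {a} {b} u a≢b apart = Stuttering⇒¬Alternate {w = blockWord (2 + k) cs} a≢b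
    (subst Stuttering (sym (restrict-blockWord a b (2 + k) cs))
      (blockWord-Stuttering k _ (All.map⁺ (All.tabulate short))))
    where
    short : ∀ {c} → c ∈ cs → length (restrict a b c) ≤ 1
    short {c} c∈cs =
      Unique∧constant⇒length≤1 (Unique.filter⁺ _ (All.lookup (Unique-concat⁻ cs u) c∈cs)) constant
      where
      constant : ∀ {y z} → y ∈ restrict a b c → z ∈ restrict a b c → y ≡ z
      constant y∈ z∈ with ∈-restrict⁻ {a = a} {b} {c} y∈ | ∈-restrict⁻ {a = a} {b} {c} z∈
      ... | _   , inj₁ refl | _   , inj₁ refl = refl
      ... | _   , inj₂ refl | _   , inj₂ refl = refl
      ... | a∈c , inj₁ refl | b∈c , inj₂ refl = contradiction b∈c (apart c∈cs a∈c)
      ... | b∈c , inj₂ refl | a∈c , inj₁ refl = contradiction b∈c (apart c∈cs a∈c)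

trues falses : ℕ → List Bool
trues  m = replicate m true
falses m = replicate m false

blocksAux-true≤blocks : ∀ bs → blocksAux true bs ≤ blocks bs
blocksAux-true≤blocks []           = z≤n
blocksAux-true≤blocks (false ∷ bs) = ≤-refl
blocksAux-true≤blocks (true ∷ bs)  = n≤1+n _

blocksAux-++ : ∀ prev bs cs → blocksAux prev (bs ++ cs) ≤ blocksAux prev bs + blocks cs
blocksAux-++ false []           cs = ≤-refl
blocksAux-++ true  []           cs = blocksAux-true≤blocks cs
blocksAux-++ prev  (false ∷ bs) cs = blocksAux-++ false bs cs
blocksAux-++ false (true ∷ bs)  cs = s≤s (blocksAux-++ true bs cs)
blocksAux-++ true  (true ∷ bs)  cs = blocksAux-++ true bs cs

blocks-++ : ∀ bs cs → blocks (bs ++ cs) ≤ blocks bs + blocks cs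
blocks-++ = blocksAux-++ false

blocksAux-falses : ∀ prev m → blocksAux prev (falses m) ≡ 0
blocksAux-falses prev zero    = refl
blocksAux-falses prev (suc m) = blocksAux-falses false m

blocks-++-falses : ∀ bs m → blocks (bs ++ falses m) ≤ blocks bs
blocks-++-falses bs m = begin
  blocks (bs ++ falses m)        ≤⟨ blocks-++ bs _ ⟩
  blocks bs + blocks (falses m)  ≡⟨ cong (blocks bs +_) (blocksAux-falses false m) ⟩
  blocks bs + 0                  ≡⟨ +-identityʳ _ ⟩
  blocks bs                      ∎
  where open ≤-Reasoning

blocks-trues-falses : ∀ j l → blocks (trues j ++ falses l) ≤ 1
blocks-trues-falses zero    l = ≤-trans (≤-reflexive (blocksAux-falses false l)) z≤n
blocks-trues-falses (suc j) l = s≤s (≤-reflexive (inside j))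
  where
  inside : ∀ j → blocksAux true (trues j ++ falses l) ≡ 0
  inside zero    = blocksAux-falses true l
  inside (suc j) = inside j

blocks-concat-replicate : ∀ k bs → blocks (concat (replicate k bs)) ≤ k * blocks bs
blocks-concat-replicate zero    bs = z≤n
blocks-concat-replicate (suc k) bs =
  ≤-trans (blocks-++ bs _) (+-monoʳ-≤ (blocks bs) (blocks-concat-replicate k bs))

-- N marked positions (earlier chunks), k copies of the current chunk with its
-- first j letters marked and l unmarked, then m unmarked positions (later chunks).
MarkingShape : ℕ → List Bool → Set
MarkingShape k bs =
  ∃[ N ] ∃[ j ] ∃[ l ] ∃[ m ] bs ≡ trues N ++ concat (replicate k (trues j ++ falses l)) ++ falses m

MarkingShape-regroup : ∀ {N j l m} (rest : List Bool) →
  trues N ++ ((trues j ++ falses l) ++ rest) ++ falses m ≡ (trues (N + j) ++ falses l) ++ rest ++ falses m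
MarkingShape-regroup {N} {j} {l} {m} rest = begin
  trues N ++ ((trues j ++ falses l) ++ rest) ++ falses m
    ≡⟨ cong (trues N ++_) (++-assoc (trues j ++ falses l) rest (falses m)) ⟩
  trues N ++ (trues j ++ falses l) ++ rest ++ falses m
    ≡⟨ cong (trues N ++_) (++-assoc (trues j) (falses l) _) ⟩
  trues N ++ trues j ++ falses l ++ rest ++ falses m
    ≡⟨ ++-assoc (trues N) (trues j) _ ⟨
  (trues N ++ trues j) ++ falses l ++ rest ++ falses m
    ≡⟨ cong (_++ falses l ++ rest ++ falses m) (replicate-++ N j) ⟩
  trues (N + j) ++ falses l ++ rest ++ falses m
    ≡⟨ ++-assoc (trues (N + j)) (falses l) _ ⟨
  (trues (N + j) ++ falses l) ++ rest ++ falses m ∎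
  where open ≡-Reasoning

blocks-MarkingShape : ∀ k {bs} → MarkingShape (suc k) bs → blocks bs ≤ suc k
blocks-MarkingShape k (N , j , l , m , refl) = begin
  blocks (trues N ++ (chunk ++ rest) ++ falses m)
    ≡⟨ cong blocks (MarkingShape-regroup {N} {j} {l} {m} rest) ⟩
  blocks ((trues (N + j) ++ falses l) ++ rest ++ falses m)
    ≤⟨ blocks-++ (trues (N + j) ++ falses l) _ ⟩
  blocks (trues (N + j) ++ falses l) + blocks (rest ++ falses m)
    ≤⟨ +-mono-≤ (blocks-trues-falses (N + j) l) (blocks-++-falses rest m) ⟩
  1 + blocks rest
    ≤⟨ +-monoʳ-≤ 1 (blocks-concat-replicate k chunk) ⟩
  1 + k * blocks chunk
    ≤⟨ +-monoʳ-≤ 1 (*-monoʳ-≤ k (blocks-trues-falses j l)) ⟩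
  1 + k * 1
    ≡⟨ cong suc (*-identityʳ k) ⟩
  suc k ∎
  where
  open ≤-Reasoning
  chunk = trues j ++ falses l
  rest  = concat (replicate k chunk)

module _ {n : ℕ} where
  open DecMembership (_≟_ {n}) using (_∈?_)

  -- Defs.marked σ i w unfolds to map (mark (take i σ)) w.
  mark : Word n → Fin n → Bool
  mark M x = does (x ∈? M)

  map-mark-⊆ : ∀ {M u} → All (_∈ M) u → map (mark M) u ≡ trues (length u)
  map-mark-⊆     []          = refl
  map-mark-⊆ {M} (x∈M ∷ ⊆M) = cong₂ _∷_ (dec-true (_ ∈? M) x∈M) (map-mark-⊆ ⊆M)

  map-mark-disjoint : ∀ {M u} → All (_∉ M) u → map (mark M) u ≡ falses (length u)
  map-mark-disjoint     []          = refl
  map-mark-disjoint {M} (x∉M ∷ #M) = cong₂ _∷_ (dec-false (_ ∈? M) x∉M) (map-mark-disjoint #M)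

  mark-++-∉ : ∀ M₁ M₂ {x} → x ∉ M₁ → mark (M₁ ++ M₂) x ≡ mark M₂ x
  mark-++-∉ M₁ M₂ {x} x∉M₁ with x ∈? M₂
  ... | yes x∈M₂ = dec-true  (x ∈? M₁ ++ M₂) (∈-++⁺ʳ M₁ x∈M₂)
  ... | no  x∉M₂ = dec-false (x ∈? M₁ ++ M₂) ([ x∉M₁ , x∉M₂ ]′ ∘ ∈-++⁻ M₁)

  map-mark-++-disjoint : ∀ M₁ M₂ {u} → All (_∉ M₁) u → map (mark (M₁ ++ M₂)) u ≡ map (mark M₂) u
  map-mark-++-disjoint M₁ M₂ = map-cong-local ∘ All.map (mark-++-∉ M₁ M₂)

  map-mark-take : ∀ i {u} → Unique u →
                  map (mark (take i u)) u ≡ trues (length (take i u)) ++ falses (length (drop i u))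
  map-mark-take zero    _                 = map-mark-disjoint {M = []} (All.tabulate λ _ ())
  map-mark-take (suc i) {[]}    _          = refl
  map-mark-take (suc i) {x ∷ u} (x∉u ∷ uu) = cong₂ _∷_ (dec-true (x ∈? x ∷ take i u) (here refl))
    (trans (map-mark-++-disjoint (x ∷ []) (take i u) (All.map (λ x≢y → λ { (here refl) → x≢y refl }) x∉u))
           (map-mark-take i uu))

  map-mark-blockWord-current : ∀ k i {c} cs → Unique c → Disjoint c (concat cs) →
    map (mark (take i c)) (pow k c ++ blockWord k cs)
      ≡ concat (replicate k (trues (length (take i c)) ++ falses (length (drop i c))))
          ++ falses (length (blockWord k cs))
  map-mark-blockWord-current k i {c} cs uc c#σ = begin
    map (mark (take i c)) (pow k c ++ blockWord k cs)
      ≡⟨ map-++ _ (pow k c) _ ⟩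
    map (mark (take i c)) (pow k c) ++ map (mark (take i c)) (blockWord k cs)
      ≡⟨ cong₂ _++_ (map-concat-replicate _ k c) (map-mark-disjoint (All.tabulate later-unmarked)) ⟩
    concat (replicate k (map (mark (take i c)) c)) ++ falses (length (blockWord k cs))
      ≡⟨ cong (λ bs → concat (replicate k bs) ++ _) (map-mark-take i uc) ⟩
    concat (replicate k (trues (length (take i c)) ++ falses (length (drop i c))))
      ++ falses (length (blockWord k cs)) ∎
    where
    open ≡-Reasoning
    later-unmarked : ∀ {x} → x ∈ blockWord k cs → x ∉ take i c
    later-unmarked x∈w x∈c↑i = c#σ (∈-take⁻ i x∈c↑i , ∈-blockWord⁻ k cs x∈w)

  map-mark-blockWord-past : ∀ k c M cs → Disjoint c (concat cs) →
    map (mark (c ++ M)) (pow k c ++ blockWord k cs) ≡ trues (length (pow k c)) ++ map (mark M) (blockWord k cs)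
  map-mark-blockWord-past k c M cs c#σ = trans (map-++ _ (pow k c) _) (cong₂ _++_
    (map-mark-⊆ (All.tabulate (∈-++⁺ˡ ∘ ∈-pow⁻ k)))
    (map-mark-++-disjoint c M (All.tabulate λ x∈w x∈c → c#σ (x∈c , ∈-blockWord⁻ k cs x∈w))))

  marked-blockWord : ∀ k cs → Unique (concat cs) → ∀ i →
                     MarkingShape k (map (mark (take i (concat cs))) (blockWord k cs))
  marked-blockWord k []       _ i = 0 , 0 , 0 , 0 , sym (cong (_++ []) (concat-replicate-[] k))
  marked-blockWord k (c ∷ cs) u i with Unique-++⁻ c u | take-++-cases i c (concat cs)
  ... | uc , _  , c#σ | inj₁ σ↑i≡c↑i = 0 , length (take i c) , length (drop i c) , length (blockWord k cs) ,
    trans (cong (λ M → map (mark M) (blockWord k (c ∷ cs))) σ↑i≡c↑i)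
          (map-mark-blockWord-current k i cs uc c#σ)
  ... | _  , uσ , c#σ | inj₂ (i′ , σ↑i≡c++σ↑i′) with marked-blockWord k cs uσ i′
  ...   | N , j , l , m , shape = length (pow k c) + N , j , l , m , (begin
    map (mark (take i (c ++ concat cs))) (blockWord k (c ∷ cs))
      ≡⟨ cong (λ M → map (mark M) (blockWord k (c ∷ cs))) σ↑i≡c++σ↑i′ ⟩
    map (mark (c ++ take i′ (concat cs))) (blockWord k (c ∷ cs))
      ≡⟨ map-mark-blockWord-past k c _ cs c#σ ⟩
    trues (length (pow k c)) ++ map (mark (take i′ (concat cs))) (blockWord k cs)
      ≡⟨ cong (trues (length (pow k c)) ++_) shape ⟩
    trues (length (pow k c)) ++ trues N ++ rest
      ≡⟨ ++-assoc (trues (length (pow k c))) (trues N) rest ⟨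
    (trues (length (pow k c)) ++ trues N) ++ rest
      ≡⟨ cong (_++ rest) (replicate-++ (length (pow k c)) N) ⟩
    trues (length (pow k c) + N) ++ rest ∎)
    where
    open ≡-Reasoning
    rest = concat (replicate k (trues j ++ falses l)) ++ falses m

  blockWord-Local : ∀ k cs → Unique (concat cs) → Local (suc k) (blockWord (suc k) cs)
  blockWord-Local k cs u =
    concat cs , (u , λ x → mk⇔ (∈-blockWord⁺ k cs) (∈-blockWord⁻ (suc k) cs)) ,
    λ i _ → blocks-MarkingShape k (marked-blockWord (suc k) cs u i)

module _ {n : ℕ} (P : Partition n) where

  firstRelated : List (Fin n) → Fin n → Fin n
  firstRelated []       x = x
  firstRelated (y ∷ ys) x = if same P y x then y else firstRelated ys x

  firstRelated-same : ∀ ys x → same P (firstRelated ys x) x ≡ true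
  firstRelated-same []       x = same-refl P x
  firstRelated-same (y ∷ ys) x with same P y x in yx
  ... | true  = yx
  ... | false = firstRelated-same ys x

  same-respʳ : ∀ y {a b} → same P a b ≡ true → same P y a ≡ same P y b
  same-respʳ y {a} {b} ab with same P y a in ya | same P y b in yb
  ... | true  | true  = refl
  ... | false | false = refl
  ... | true  | false with () ← trans (sym (same-trans P y a b ya ab)) yb
  ... | false | true  with () ← trans (sym (same-trans P y b a yb (trans (same-sym P b a) ab))) ya

  firstRelated-cong : ∀ ys {a b} → a ∈ ys → same P a b ≡ true → firstRelated ys a ≡ firstRelated ys b
  firstRelated-cong (y ∷ ys) {a} {b} a∈ ab rewrite same-respʳ y ab with same P y b in yb | a∈
  ... | true  | _          = refl
  ... | false | here refl  with () ← trans (sym ab) yb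
  ... | false | there a∈ys = firstRelated-cong ys a∈ys ab

  representative : Fin n → Fin n
  representative = firstRelated (allFin n)

  representative-same⁺ : ∀ {a b} → same P a b ≡ true → representative a ≡ representative b
  representative-same⁺ = firstRelated-cong (allFin n) (∈-allFin _)

  representative-same⁻ : ∀ {a b} → representative a ≡ representative b → same P a b ≡ true
  representative-same⁻ {a} {b} ra≡rb = same-trans P a (representative a) b
    (trans (same-sym P a _) (firstRelated-same (allFin n) a))
    (subst (λ r → same P r b ≡ true) (sym ra≡rb) (firstRelated-same (allFin n) b))

  class : Fin n → Word n
  class r = filter (λ x → representative x ≟ r) (allFin n)

  -- class r is empty unless r is a representative; empty chunks vanish from block words.
  classes : List (Word n)
  classes = map class (allFin n)

  ∈-class⁺ : ∀ {x r} → representative x ≡ r → x ∈ class r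
  ∈-class⁺ {x} = ∈-filter⁺ _ (∈-allFin x)

  ∈-class⁻ : ∀ {x r} → x ∈ class r → representative x ≡ r
  ∈-class⁻ {r = r} = proj₂ ∘ ∈-filter⁻ (λ x → representative x ≟ r) {xs = allFin n}

  classes-Unique : Unique (concat classes)
  classes-Unique = Unique.concat⁺
    (All.map⁺ (All.universal (λ _ → Unique.filter⁺ _ (Unique.allFin⁺ n)) _))
    (AllPairs.map⁺ (AllPairs.map disjoint (Unique.allFin⁺ n)))
    where
    disjoint : ∀ {r r′} → r ≢ r′ → Disjoint (class r) (class r′)
    disjoint r≢r′ (x∈r , x∈r′) = r≢r′ (trans (sym (∈-class⁻ x∈r)) (∈-class⁻ x∈r′))

  ∈-classes : ∀ x → x ∈ concat classes
  ∈-classes x = ∈-concat⁺′ (∈-class⁺ refl) (∈-map⁺ class (∈-allFin (representative x)))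

  classes-same : ∀ {c a b} → c ∈ classes → a ∈ c → b ∈ c → same P a b ≡ true
  classes-same c∈ a∈c b∈c with ∈-map⁻ class c∈
  ... | r , _ , refl = representative-same⁻ (trans (∈-class⁻ a∈c) (sym (∈-class⁻ b∈c)))

  blockWord-classes-Alternate⇔same : ∀ k {a b} → a ≢ b →
                                     Alternate a b (blockWord (2 + k) classes) ⇔ same P a b ≡ true
  blockWord-classes-Alternate⇔same k {a} {b} a≢b = mk⇔ to from
    where
    to : Alternate a b (blockWord (2 + k) classes) → same P a b ≡ true
    to alt with same P a b in ab
    ... | true  = refl
    ... | false = contradiction alt (blockWord-¬Alternate k classes-Unique a≢b
                    λ c∈ a∈c b∈c → case trans (sym (classes-same c∈ a∈c b∈c)) ab of λ ())
    from : same P a b ≡ true → Alternate a b (blockWord (2 + k) classes)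
    from ab = blockWord-Alternate (suc k) classes-Unique a≢b (∈-map⁺ class (∈-allFin (representative a)))
                (∈-class⁺ refl) (∈-class⁺ (sym (representative-same⁺ ab)))

does-≟-sym : ∀ {n} (a b : Fin n) → does (a ≟ b) ≡ does (b ≟ a)
does-≟-sym a b with a ≟ b | b ≟ a
... | yes _   | yes _   = refl
... | no  _   | no  _   = refl
... | yes a≡b | no  b≢a = contradiction (sym a≡b) b≢a
... | no  a≢b | yes b≡a = contradiction (sym b≡a) a≢b

partitionGraph : ∀ {n} → Partition n → Graph n
partitionGraph P = record
  { adj   = λ a b → not (does (a ≟ b)) ∧ same P a b
  ; symm  = λ a b → cong₂ (λ d s → not d ∧ s) (does-≟-sym a b) (same-sym P a b)
  ; irrfl = λ a → cong (λ d → not d ∧ same P a a) (dec-true (a ≟ a) refl)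
  }

partitionGraph-adj : ∀ {n} (P : Partition n) {a b} → a ≢ b → adj (partitionGraph P) a b ≡ same P a b
partitionGraph-adj P {a} {b} a≢b = cong (λ d → not d ∧ same P a b) (dec-false (a ≟ b) a≢b)

partitionGraph-injective : ∀ {n} (P Q : Partition n) → partitionGraph P ≈G partitionGraph Q → P ≈P Q
partitionGraph-injective P Q G≈H a b with a ≟ b
... | yes refl = trans (same-refl P a) (sym (same-refl Q a))
... | no  a≢b  = trans (sym (partitionGraph-adj P a≢b)) (trans (G≈H a b) (partitionGraph-adj Q a≢b))

blockWord-classes-Represents : ∀ k {n} (P : Partition n) →
                               Represents (blockWord (2 + k) (classes P)) (partitionGraph P)
blockWord-classes-Represents k P =
  (λ a → ∈-blockWord⁺ (suc k) (classes P) (∈-classes P a)) ,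
  (λ a b a≢b → subst (λ s → Alternate a b (blockWord (2 + k) (classes P)) ⇔ s ≡ true)
                     (sym (partitionGraph-adj P a≢b)) (blockWord-classes-Alternate⇔same P k a≢b))

mainTheorem5 : (k : ℕ) → 2 ≤ k → (n : ℕ) → BellLe (InR k) n × BellLe (InL k) n
mainTheorem5 (suc (suc k)) (s≤s (s≤s z≤n)) n =
  (partitionGraph , (λ P → word P , uniform P , represents P) , partitionGraph-injective) ,
  (partitionGraph , (λ P → word P , local P , represents P) , partitionGraph-injective)
  where
  word : Partition n → Word n
  word P = blockWord (2 + k) (classes P)
  uniform : (P : Partition n) → Uniform (suc (suc k)) (word P)
  uniform P = blockWord-Uniform (2 + k) (classes P) (classes-Unique P) (∈-classes P)
  local : (P : Partition n) → Local (suc (suc k)) (word P)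
  local P = blockWord-Local (suc k) (classes P) (classes-Unique P)
  represents : (P : Partition n) → Represents (word P) (partitionGraph P)
  represents = blockWord-classes-Represents k
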